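{- For all closed terms $P,Q$, every RVA $\mathbb{A}$ in the variety $st$ and every $H\in\mathbb{A}$, we have $P/\partial_Q(H)=P/H$.
   Context: Fix a finite non-empty set $A$ of atomic propositions. Closed terms are built from $T$, $F$, $a\in A$ by conditional composition $P\triangleleft Q\triangleright R$. A reactive valuation algebra (RVA) is a set $RV$ with elements $T_{RV},F_{RV}$ and for each $a\in A$ functions $y_a:RV\to\{T,F\}$, $\partial_a:RV\to RV$ with $y_a(T_{RV})=T$, $y_a(F_{RV})=F$, $\partial_a(T_{RV})=T_{RV}$, $\partial_a(F_{RV})=F_{RV}$. For closed $P$ and $H\in RV$: $T/H=T$, $F/H=F$, $a/H=y_a(H)$, $\partial_T(H)=\partial_F(H)=H$; $(P\triangleleft Q\triangleright R)/H=P/\partial_Q(H)$ and $\partial_{P\triangleleft Q\triangleright R}(H)=\partial_P(\partial_Q(H))$ if $Q/H=T$, and $R/\partial_Q(H)$ resp. $\partial_R(\partial_Q(H))$ if $Q/H=F$. The variety $st$ is the class of RVAs with $y_a(\partial_b(H))=y_a(H)$ for all $a,b\in A$ and all $H$. -}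

module Defs where

open import Data.Bool using (Bool; true; false)
open import Data.Nat using (ℕ; suc)
open import Data.Fin using (Fin)
open import Data.Product using (Σ; _×_; _,_; proj₁; proj₂)
open import Function.Bundles using (_↔_)
open import Relation.Binary.PropositionalEquality using (_≡_)

IsFiniteNonEmpty : Set → Set
IsFiniteNonEmpty A = Σ ℕ (λ n → A ↔ Fin (suc n))

-- Closed terms over atoms A: T, F, atoms, and conditional composition
-- cond P Q R  stands for  P ◁ Q ▷ R.
data Term (A : Set) : Set where
  T F  : Term A
  atom : A → Term A
  cond : Term A → Term A → Term A → Term A

record RVA (A : Set) : Set₁ where
  field
    Carrier : Set
    T-RV F-RV : Carrier
    y  : A → Carrier → Bool
    ∂  : A → Carrier → Carrier
    y-T : ∀ a → y a T-RV ≡ true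
    y-F : ∀ a → y a F-RV ≡ false
    ∂-T : ∀ a → ∂ a T-RV ≡ T-RV
    ∂-F : ∀ a → ∂ a F-RV ≡ F-RV

module _ {A : Set} (𝔸 : RVA A) where
  open RVA 𝔸

  eval : Term A → Carrier → Bool × Carrier
  eval T H = true , H
  eval F H = false , H
  eval (atom a) H = y a H , ∂ a H
  eval (cond P Q R) H with eval Q H
  ... | true  , H' = eval P H'
  ... | false , H' = eval R H'

  _/_ : Term A → Carrier → Bool
  P / H = proj₁ (eval P H)

  ∂[_] : Term A → Carrier → Carrier
  ∂[ P ] H = proj₂ (eval P H)

InSt : {A : Set} → RVA A → Set
InSt {A} 𝔸 = ∀ (a b : A) (H : Carrier) → y a (∂ b H) ≡ y a H
  where open RVA 𝔸

module Submission where

open import Defs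
open import Data.Bool using (true; false)
open import Data.Product using (_,_)
open import Relation.Binary.PropositionalEquality using (_≡_; refl; sym; trans)

-- In st no reply ever changes the value of an atom, so every state reachable from H
-- answers each atom as H does, and the reply to P depends only on those answers.

module _ {A : Set} (𝔸 : RVA A) (st : InSt 𝔸) where
  open RVA 𝔸

  AgreeOnAtoms : Carrier → Carrier → Set
  AgreeOnAtoms G H = ∀ a → y a G ≡ y a H

  agreeOnAtoms-trans : ∀ {G H K} → AgreeOnAtoms G H → AgreeOnAtoms H K → AgreeOnAtoms G K
  agreeOnAtoms-trans eGH eHK a = trans (eGH a) (eHK a)

  agreeOnAtoms-sym : ∀ {G H} → AgreeOnAtoms G H → AgreeOnAtoms H G
  agreeOnAtoms-sym e a = sym (e a)

  ∂-agreeOnAtoms : ∀ Q H → AgreeOnAtoms (∂[_] 𝔸 Q H) H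
  ∂-agreeOnAtoms T H a = refl
  ∂-agreeOnAtoms F H a = refl
  ∂-agreeOnAtoms (atom b) H a = st a b H
  ∂-agreeOnAtoms (cond P Q R) H with eval 𝔸 Q H | ∂-agreeOnAtoms Q H
  ... | true  , H′ | eQ = agreeOnAtoms-trans (∂-agreeOnAtoms P H′) eQ
  ... | false , H′ | eQ = agreeOnAtoms-trans (∂-agreeOnAtoms R H′) eQ

  /-cong-agreeOnAtoms : ∀ P {G H} → AgreeOnAtoms G H → _/_ 𝔸 P G ≡ _/_ 𝔸 P H
  /-cong-agreeOnAtoms T e = refl
  /-cong-agreeOnAtoms F e = refl
  /-cong-agreeOnAtoms (atom a) e = e a
  /-cong-agreeOnAtoms (cond P Q R) {G} {H} e
    with eval 𝔸 Q G | eval 𝔸 Q H | /-cong-agreeOnAtoms Q e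
       | ∂-agreeOnAtoms Q G | ∂-agreeOnAtoms Q H
  ... | true  , G′ | true  , H′ | _ | eG | eH =
    /-cong-agreeOnAtoms P (agreeOnAtoms-trans eG (agreeOnAtoms-trans e (agreeOnAtoms-sym eH)))
  ... | false , G′ | false , H′ | _ | eG | eH =
    /-cong-agreeOnAtoms R (agreeOnAtoms-trans eG (agreeOnAtoms-trans e (agreeOnAtoms-sym eH)))
  ... | true  , _ | false , _ | () | _ | _
  ... | false , _ | true  , _ | () | _ | _

mainTheorem15 : (A : Set) → IsFiniteNonEmpty A →
    (P Q : Term A) (𝔸 : RVA A) → InSt 𝔸 →
    (H : RVA.Carrier 𝔸) →
    _/_ 𝔸 P (∂[_] 𝔸 Q H) ≡ _/_ 𝔸 P H
mainTheorem15 A _ P Q 𝔸 st H =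
  /-cong-agreeOnAtoms 𝔸 st P (∂-agreeOnAtoms 𝔸 st Q H)
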